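{- For every $\mathbb{T}$-automaton $m$ with finite $B$ and every state $x\in X$, the formal power series $[\![x]\!]_m:A^*\to B$ is rational, i.e. the set $\{\partial_w([\![x]\!]_m)\mid w\in A^*\}$ is finite, where $\partial_w(\sigma)=\lambda v.\,\sigma(wv)$.
   Context: $A$ is a finite set of actions, $L=B\times(-)^A$, final coalgebra $B^{A^*}$ with $o(\sigma)=\sigma(\varepsilon)$, $\partial_a\sigma=\lambda w.\sigma(aw)$. $\mathbb{T}$ is a finitary monad on $\mathbf{Set}$ and $B$ a finitely generated $\mathbb{T}$-algebra. A $\mathbb{T}$-automaton $m$ consists of a finite set $X$, maps $o^m:X\to B$, $t^m:A\times X\to TX$ and a $\mathbb{T}$-algebra $a^m:TB\to B$. Its trace semantics: the unique $\mathbb{T}$-algebra morphism $m^\sharp:TX\to B\times(TX)^A$ with $m^\sharp\circ\eta=\langle o^m,t^m\rangle$ makes $TX$ an $L$-coalgebra, and $[\![x]\!]_m$ is the image of $\eta(x)$ under the unique $L$-coalgebra morphism $TX\to B^{A^*}$. -}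

module Defs where

open import Data.Nat using (ℕ)
open import Data.Fin using (Fin)
open import Data.List using (List; []; _∷_; _++_)
open import Data.Product using (Σ; ∃; _×_; _,_)
open import Function using (id; _∘_)
open import Function.Bundles using (_↔_)
open import Relation.Binary.PropositionalEquality using (_≡_)

Finite : Set → Set
Finite X = Σ ℕ λ n → X ↔ Fin n

-- Equations are stated pointwise (no function extensionality in Agda);
-- map-cong records that T acts on functions (which in Set are extensional).
record Monad : Set₁ where
  field
    T        : Set → Set
    map      : {X Y : Set} → (X → Y) → T X → T Y
    η        : {X : Set} → X → T X
    μ        : {X : Set} → T (T X) → T X
    map-cong : {X Y : Set} {f g : X → Y} → (∀ x → f x ≡ g x) → ∀ t → map f t ≡ map g t
    map-id   : {X : Set} (t : T X) → map id t ≡ t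
    map-∘    : {X Y Z : Set} (f : X → Y) (g : Y → Z) (t : T X) → map (g ∘ f) t ≡ map g (map f t)
    η-nat    : {X Y : Set} (f : X → Y) (x : X) → map f (η x) ≡ η (f x)
    μ-nat    : {X Y : Set} (f : X → Y) (t : T (T X)) → map f (μ t) ≡ μ (map (map f) t)
    μ-η      : {X : Set} (t : T X) → μ (η t) ≡ t
    μ-mapη   : {X : Set} (t : T X) → μ (map η t) ≡ t
    μ-assoc  : {X : Set} (t : T (T (T X))) → μ (μ t) ≡ μ (map μ t)

Finitary : Monad → Set₁
Finitary M = ∀ (X : Set) (t : T X) →
  Σ ℕ λ n → Σ (Fin n → X) λ i → Σ (T (Fin n)) λ s → map i s ≡ t
  where open Monad M

record IsAlgebra (M : Monad) (B : Set) (a : Monad.T M B → B) : Set where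
  open Monad M
  field
    alg-η : (b : B) → a (η b) ≡ b
    alg-μ : (t : T (T B)) → a (μ t) ≡ a (map a t)

FinitelyGenerated : (M : Monad) {B : Set} → (Monad.T M B → B) → Set
FinitelyGenerated M {B} a =
  Σ ℕ λ n → Σ (Fin n → B) λ g → ∀ (b : B) → Σ (T (Fin n)) λ s → a (map g s) ≡ b
  where open Monad M

record Automaton (M : Monad) (A B : Set) : Set₁ where
  open Monad M
  field
    X        : Set
    X-finite : Finite X
    out      : X → B
    trans    : A → X → T X
    alg      : T B → B
    alg-law  : IsAlgebra M B alg

module _ {M : Monad} {A B : Set} (m : Automaton M A B) where
  open Monad M
  open Automaton m

  -- m♯ : T X → B × (T X)^A, the unique T-algebra morphism extending
  -- ⟨out, trans⟩ (B × (TX)^A carries the algebra alg × (μ)^A):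
  -- m♯ = ⟨ alg ∘ T out , λ a → μ ∘ T (trans a) ⟩.
  out♯ : T X → B
  out♯ s = alg (map out s)

  next♯ : A → T X → T X
  next♯ a s = μ (map (trans a) s)

  -- The unique L-coalgebra morphism T X → B^{A*} (final coalgebra),
  -- where L = B × (-)^A and words are lists.
  beh : T X → List A → B
  beh s []      = out♯ s
  beh s (a ∷ w) = beh (next♯ a s) w

  ⟦_⟧ : X → List A → B
  ⟦ x ⟧ = beh (η x)

∂ : {A B : Set} → List A → (List A → B) → List A → B
∂ w σ v = σ (w ++ v)

Rational : {A B : Set} → (List A → B) → Set
Rational {A} σ =
  Σ ℕ λ n → Σ (Fin n → List A) λ ws →
    ∀ (w : List A) → Σ (Fin n) λ i → ∀ (v : List A) → ∂ w σ v ≡ ∂ (ws i) σ v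

-- The state space T X of the determinised automaton may be infinite, but the
-- behaviour of a state s only depends on the functional  d ↦ alg (T d s)  on
-- valuations d : X → B, and since X and B are finite there are only finitely
-- many such functionals up to pointwise equality.  Identifying states with the
-- same functional is a congruence for the transitions, so a pigeonhole
-- argument on prefixes replaces every word by one of bounded length reaching
-- the same derivative.
module Submission where

open import Defs
open import Data.Nat using (ℕ; zero; suc; _+_; _∸_; _^_; _≤_; _<_; _⊓_; s≤s; _≤?_; z≤n)
open import Data.Nat.Properties
  using (≤-trans; ≤-refl; m⊓n≤m; +-monoˡ-≤; +-monoˡ-<; m+[n∸m]≡n; ≰⇒>; <⇒≤; ≤-pred)
import Data.Fin as Fin
open import Data.Fin using (Fin; toℕ; combine; funToFin; finToFun)
open import Data.Fin.Properties using (pigeonhole; toℕ≤pred[n]; finToFun-funToFin)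
open import Data.List using (List; []; _∷_; _++_; length; take; drop; lookup; allFin; cartesianProductWith)
import Data.List as List
open import Data.List.Properties using (length-take; length-drop; take++drop≡id; length-++)
open import Data.List.Relation.Unary.Any as Any using (index)
open import Data.List.Relation.Unary.Any.Properties using (lookup-index)
open import Data.List.Membership.Propositional using (_∈_)
open import Data.List.Membership.Propositional.Properties
  using (∈-allFin; ∈-map⁺; ∈-cartesianProductWith⁺)
open import Data.Product using (∃; _×_; _,_; proj₁; proj₂)
open import Function using (_∘_)
open import Function.Bundles using (Inverse)
open import Function.Properties.Inverse using (↔-refl)
open import Relation.Nullary using (yes; no)
open import Relation.Binary.PropositionalEquality
  using (_≡_; refl; sym; trans; cong; cong₂; subst; _≗_; module ≡-Reasoning)

funToFin-cong : {m n : ℕ} {f g : Fin m → Fin n} → f ≗ g → funToFin f ≡ funToFin g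
funToFin-cong {zero}  f≗g = refl
funToFin-cong {suc m} f≗g = cong₂ combine (f≗g Fin.zero) (funToFin-cong (f≗g ∘ Fin.suc))

module FunctionCode {X B : Set} (finX : Finite X) (finB : Finite B) where
  private
    nX = proj₁ finX
    nB = proj₁ finB
    module IX = Inverse (proj₂ finX)
    module IB = Inverse (proj₂ finB)

  encode : (X → B) → Fin (nB ^ nX)
  encode f = funToFin (IB.to ∘ f ∘ IX.from)

  decode : Fin (nB ^ nX) → X → B
  decode k = IB.from ∘ finToFun k ∘ IX.to

  decode-encode : (f : X → B) → decode (encode f) ≗ f
  decode-encode f x = begin
    IB.from (finToFun (encode f) (IX.to x))  ≡⟨ cong IB.from (finToFun-funToFin _ (IX.to x)) ⟩
    IB.from (IB.to (f (IX.from (IX.to x)))) ≡⟨ IB.strictlyInverseʳ _ ⟩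
    f (IX.from (IX.to x))                    ≡⟨ cong f (IX.strictlyInverseʳ x) ⟩
    f x                                      ∎
    where open ≡-Reasoning

  encode-cong : {f g : X → B} → f ≗ g → encode f ≡ encode g
  encode-cong f≗g = funToFin-cong (cong IB.to ∘ f≗g ∘ IX.from)

enumerate : {A : Set} → Finite A → List A
enumerate (n , A↔Fin) = List.map (Inverse.from A↔Fin) (allFin n)

∈-enumerate : {A : Set} (finA : Finite A) (a : A) → a ∈ enumerate finA
∈-enumerate (n , A↔Fin) a = subst (_∈ _) (Inverse.strictlyInverseʳ A↔Fin a)
  (∈-map⁺ (Inverse.from A↔Fin) (∈-allFin (Inverse.to A↔Fin a)))

wordsOfLength≤ : {A : Set} → List A → ℕ → List (List A)
wordsOfLength≤ as zero    = [] ∷ []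
wordsOfLength≤ as (suc n) = [] ∷ cartesianProductWith _∷_ as (wordsOfLength≤ as n)

∈-wordsOfLength≤ : {A : Set} {as : List A} → (∀ a → a ∈ as) →
  ∀ n (u : List A) → length u ≤ n → u ∈ wordsOfLength≤ as n
∈-wordsOfLength≤ all∈ zero    []      _       = Any.here refl
∈-wordsOfLength≤ all∈ (suc n) []      _       = Any.here refl
∈-wordsOfLength≤ all∈ (suc n) (a ∷ u) (s≤s l) =
  Any.there (∈-cartesianProductWith⁺ _∷_ (all∈ a) (∈-wordsOfLength≤ all∈ n u l))

length-take++drop< : {A : Set} (u : List A) {i j : ℕ} → i < j → j ≤ length u →
  length (take i u ++ drop j u) < length u
length-take++drop< u {i} {j} i<j j≤∣u∣ = begin-strict
  length (take i u ++ drop j u)         ≡⟨ length-++ (take i u) ⟩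
  length (take i u) + length (drop j u) ≡⟨ cong₂ _+_ (length-take i u) (length-drop j u) ⟩
  i ⊓ length u + (length u ∸ j)         ≤⟨ +-monoˡ-≤ _ (m⊓n≤m i (length u)) ⟩
  i + (length u ∸ j)                    <⟨ +-monoˡ-< _ i<j ⟩
  j + (length u ∸ j)                    ≡⟨ m+[n∸m]≡n j≤∣u∣ ⟩
  length u                              ∎
  where open Data.Nat.Properties.≤-Reasoning

module FiniteCongruence {A S : Set} (δ : A → S → S) {N : ℕ} (κ : S → Fin N)
  (κ-δ : ∀ a {s s'} → κ s ≡ κ s' → κ (δ a s) ≡ κ (δ a s')) where

  run : List A → S → S
  run []      s = s
  run (a ∷ u) s = run u (δ a s)

  run-++ : ∀ u v s → run (u ++ v) s ≡ run v (run u s)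
  run-++ []      v s = refl
  run-++ (a ∷ u) v s = run-++ u v (δ a s)

  run-cong : ∀ v {s s'} → κ s ≡ κ s' → κ (run v s) ≡ κ (run v s')
  run-cong []      κs≡κs' = κs≡κs'
  run-cong (a ∷ v) κs≡κs' = run-cong v (κ-δ a κs≡κs')

  -- Two of the prefixes of lengths 0, …, N reach the same class; cutting out
  -- the infix between them does not change the class reached by u.
  shorten : ∀ u s → length u ≤ suc N →
    ∃ λ u' → length u' ≤ N × κ (run u s) ≡ κ (run u' s)
  shorten u s ∣u∣≤1+N with length u ≤? N
  ... | yes ∣u∣≤N = u , ∣u∣≤N , refl
  ... | no  ∣u∣≰N with i , j , i<j , κi≡κj ← pigeonhole ≤-refl (λ k → κ (run (take (toℕ k) u) s)) =
    take (toℕ i) u ++ drop (toℕ j) u ,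
    ≤-pred (≤-trans (length-take++drop< u i<j j≤∣u∣) ∣u∣≤1+N) ,
    (begin
      κ (run u s)                                       ≡⟨ cong (λ w → κ (run w s)) (sym (take++drop≡id (toℕ j) u)) ⟩
      κ (run (take (toℕ j) u ++ drop (toℕ j) u) s)      ≡⟨ cong κ (run-++ (take (toℕ j) u) _ s) ⟩
      κ (run (drop (toℕ j) u) (run (take (toℕ j) u) s)) ≡⟨ run-cong (drop (toℕ j) u) (sym κi≡κj) ⟩
      κ (run (drop (toℕ j) u) (run (take (toℕ i) u) s)) ≡⟨ cong κ (sym (run-++ (take (toℕ i) u) _ s)) ⟩
      κ (run (take (toℕ i) u ++ drop (toℕ j) u) s)      ∎)
    where
      open ≡-Reasoning
      j≤∣u∣ : toℕ j ≤ length u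
      j≤∣u∣ = ≤-trans (toℕ≤pred[n] j) (<⇒≤ (≰⇒> ∣u∣≰N))

  short-representative : ∀ u s → ∃ λ u' → length u' ≤ N × κ (run u s) ≡ κ (run u' s)
  short-representative []      s = [] , z≤n , refl
  short-representative (a ∷ u) s with u' , ∣u'∣≤N , κu≡κu' ← short-representative u (δ a s)
                                  with u'' , ∣u''∣≤N , κu'≡κu'' ← shorten (a ∷ u') s (s≤s ∣u'∣≤N) =
    u'' , ∣u''∣≤N , trans κu≡κu' κu'≡κu''

  module _ {B : Set} (σ : S → List A → B) (σ-δ : ∀ a s w → σ s (a ∷ w) ≡ σ (δ a s) w)
    (κ-σ : ∀ {s s'} → κ s ≡ κ s' → σ s ≗ σ s') where

    ∂-run : ∀ u s → ∂ u (σ s) ≗ σ (run u s)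
    ∂-run []      s v = refl
    ∂-run (a ∷ u) s v = trans (σ-δ a s (u ++ v)) (∂-run u (δ a s) v)

    behaviour-rational : Finite A → ∀ s → Rational (σ s)
    behaviour-rational finA s = length W , lookup W , λ w →
      let (u , ∣u∣≤N , κw≡κu) = short-representative w s
          u∈W = ∈-wordsOfLength≤ (∈-enumerate finA) N u ∣u∣≤N
      in index u∈W , λ v → begin
        ∂ w (σ s) v                      ≡⟨ ∂-run w s v ⟩
        σ (run w s) v                    ≡⟨ κ-σ κw≡κu v ⟩
        σ (run u s) v                    ≡⟨ sym (∂-run u s v) ⟩
        ∂ u (σ s) v                      ≡⟨ cong (λ u′ → ∂ u′ (σ s) v) (lookup-index u∈W) ⟩
        ∂ (lookup W (index u∈W)) (σ s) v ∎
      where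
        open ≡-Reasoning
        W = wordsOfLength≤ (enumerate finA) N

module _ {M : Monad} {A B : Set} (m : Automaton M A B) where
  open Monad M
  open Automaton m renaming (trans to t)
  open IsAlgebra alg-law

  -- The T-algebra morphism T X → B extending the valuation d, applied to s.
  eval : T X → (X → B) → B
  eval s d = alg (map d s)

  eval-cong : ∀ s {d d'} → d ≗ d' → eval s d ≡ eval s d'
  eval-cong s d≗d' = cong alg (map-cong d≗d' s)

  eval-η : ∀ x d → eval (η x) d ≡ d x
  eval-η x d = trans (cong alg (η-nat d x)) (alg-η (d x))

  eval-μ-map : ∀ s (f : X → T X) d → eval (μ (map f s)) d ≡ eval s (λ x → eval (f x) d)
  eval-μ-map s f d = begin
    alg (map d (μ (map f s)))             ≡⟨ cong alg (μ-nat d (map f s)) ⟩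
    alg (μ (map (map d) (map f s)))       ≡⟨ alg-μ _ ⟩
    alg (map alg (map (map d) (map f s))) ≡⟨ cong (alg ∘ map alg) (sym (map-∘ f (map d) s)) ⟩
    alg (map alg (map (map d ∘ f) s))     ≡⟨ cong alg (sym (map-∘ (map d ∘ f) alg s)) ⟩
    alg (map (λ x → eval (f x) d) s)      ∎
    where open ≡-Reasoning

  beh-eval : ∀ v s → beh m s v ≡ eval s (λ x → ⟦_⟧ m x v)
  beh-eval []      s = eval-cong s (λ x → sym (eval-η x out))
  beh-eval (a ∷ v) s = begin
    beh m (next♯ m a s) v                 ≡⟨ beh-eval v _ ⟩
    eval (next♯ m a s) ⟦·⟧v               ≡⟨ eval-μ-map s (t a) ⟦·⟧v ⟩
    eval s (λ x → eval (t a x) ⟦·⟧v)      ≡⟨ eval-cong s (sym ∘ ⟦⟧-∷) ⟩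
    eval s (λ x → ⟦_⟧ m x (a ∷ v))        ∎
    where
      open ≡-Reasoning
      ⟦·⟧v : X → B
      ⟦·⟧v x = ⟦_⟧ m x v
      ⟦⟧-∷ : ∀ x → ⟦_⟧ m x (a ∷ v) ≡ eval (t a x) ⟦·⟧v
      ⟦⟧-∷ x = begin
        beh m (next♯ m a (η x)) v              ≡⟨ beh-eval v _ ⟩
        eval (μ (map (t a) (η x))) ⟦·⟧v        ≡⟨ eval-μ-map (η x) (t a) ⟦·⟧v ⟩
        eval (η x) (λ y → eval (t a y) ⟦·⟧v)   ≡⟨ eval-η x _ ⟩
        eval (t a x) ⟦·⟧v                      ∎

  module _ (finB : Finite B) where
    private
      module Valuation = FunctionCode X-finite finB
      K = proj₁ finB ^ proj₁ X-finite
      module Functional = FunctionCode (K , ↔-refl) finB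

    -- Since eval s is extensional, it is determined by its values on the
    -- K representatives of valuations up to pointwise equality.
    class : T X → Fin (proj₁ finB ^ K)
    class s = Functional.encode (eval s ∘ Valuation.decode)

    class-cong : ∀ {s s'} → (∀ d → eval s d ≡ eval s' d) → class s ≡ class s'
    class-cong eval≗ = Functional.encode-cong (eval≗ ∘ Valuation.decode)

    class-injective : ∀ {s s'} → class s ≡ class s' → ∀ d → eval s d ≡ eval s' d
    class-injective {s} {s'} cs≡cs' d = begin
      eval s d                       ≡⟨ eval-cong s (sym ∘ Valuation.decode-encode d) ⟩
      eval s d̂                       ≡⟨ sym (Functional.decode-encode (eval s ∘ Valuation.decode) k) ⟩
      Functional.decode (class s) k  ≡⟨ cong (λ c → Functional.decode c k) cs≡cs' ⟩
      Functional.decode (class s') k ≡⟨ Functional.decode-encode (eval s' ∘ Valuation.decode) k ⟩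
      eval s' d̂                      ≡⟨ eval-cong s' (Valuation.decode-encode d) ⟩
      eval s' d                      ∎
      where
        open ≡-Reasoning
        k = Valuation.encode d
        d̂ = Valuation.decode k

    class-next♯ : ∀ a {s s'} → class s ≡ class s' → class (next♯ m a s) ≡ class (next♯ m a s')
    class-next♯ a {s} {s'} cs≡cs' = class-cong λ d → begin
      eval (next♯ m a s) d              ≡⟨ eval-μ-map s (t a) d ⟩
      eval s (λ x → eval (t a x) d)     ≡⟨ class-injective cs≡cs' _ ⟩
      eval s' (λ x → eval (t a x) d)    ≡⟨ sym (eval-μ-map s' (t a) d) ⟩
      eval (next♯ m a s') d             ∎
      where open ≡-Reasoning

    class-beh : ∀ {s s'} → class s ≡ class s' → beh m s ≗ beh m s'
    class-beh {s} {s'} cs≡cs' v =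
      trans (beh-eval v s) (trans (class-injective cs≡cs' _) (sym (beh-eval v s')))

proposition4 : (M : Monad) → Finitary M → (A : Set) → Finite A → (B : Set) → Finite B →
    (m : Automaton M A B) → FinitelyGenerated M (Automaton.alg m) →
    (x : Automaton.X m) → Rational (⟦_⟧ m x)
proposition4 M _ A finA B finB m _ x =
  FiniteCongruence.behaviour-rational (next♯ m) (class m finB) (class-next♯ m finB)
    (beh m) (λ _ _ _ → refl) (class-beh m finB) finA (Monad.η M x)
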